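{- In any $d$-polycube, a $d$-dimensional queen placed on a tile guards every tile of the polycube whose $\ell^1$-distance from the queen's tile is at most $2$.
   Context: A $d$-polycube is the union of finitely many unit $d$-cubes (tiles) of the standard tiling of $\mathbb{R}^d$ whose interior is connected, tiles identified with their centers in $\mathbb{Z}^d$. Two tiles are adjacent if they share a $(d-1)$-dimensional face. The $\ell^1$-distance between two tiles is the minimum number of steps in a path from one to the other in which each step moves between adjacent tiles of the polycube. A queen on tile $p$ guards $p$ and, for each nonzero $v\in\{ -1,0,1\}^d$, every $p+kv$ ($k\ge1$) with $p+jv$ a tile for all $0\le j\le k$. -}

module Defs where

open import Data.Nat using (ℕ; zero; suc; _≤_)
open import Data.Integer using (ℤ; +_; -[1+_]; _+_; _*_; _-_; ∣_∣)
open import Data.Fin using (Fin)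
open import Data.Vec using (Vec; lookup; zipWith; map)
open import Data.List using (List; [])
open import Data.List.Membership.Propositional using (_∈_)
open import Data.Product using (Σ; ∃; _×_; _,_)
open import Data.Sum using (_⊎_)
open import Relation.Binary.PropositionalEquality using (_≡_; _≢_)

-- A tile of the standard tiling of ℝ^d, identified with its centre in ℤ^d.
Tile : ℕ → Set
Tile d = Vec ℤ d

-- Two tiles are adjacent iff they share a (d-1)-face, i.e. their centres
-- differ by 1 in exactly one coordinate and agree in all others.
Adjacent : {d : ℕ} → Tile d → Tile d → Set
Adjacent {d} p q =
  Σ (Fin d) λ i → (∣ lookup p i - lookup q i ∣ ≡ 1) ×
                  (∀ j → j ≢ i → lookup p j ≡ lookup q j)

data Walk {d : ℕ} (T : List (Tile d)) : Tile d → Tile d → ℕ → Set where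
  here : ∀ {p} → p ∈ T → Walk T p p 0
  step : ∀ {p q r n} → p ∈ T → Adjacent p q → Walk T q r n → Walk T p r (suc n)

-- A d-polycube: a nonempty finite set of tiles whose union has connected
-- interior, i.e. whose face-adjacency graph is connected.
record Polycube (d : ℕ) : Set where
  field
    tiles     : List (Tile d)
    nonempty  : tiles ≢ []
    connected : ∀ {p q} → p ∈ tiles → q ∈ tiles → ∃ λ n → Walk tiles p q n

open Polycube public

-- ℓ¹-distance (shortest path length inside the polycube) is at most k.
DistLe : {d : ℕ} → Polycube d → Tile d → Tile d → ℕ → Set
DistLe P p q k = ∃ λ n → n ≤ k × Walk (tiles P) p q n

IsUnitEntry : ℤ → Set
IsUnitEntry z = z ≡ -[1+ 0 ] ⊎ z ≡ + 0 ⊎ z ≡ + 1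

IsDirection : {d : ℕ} → Vec ℤ d → Set
IsDirection {d} v = (∀ i → IsUnitEntry (lookup v i)) × Σ (Fin d) λ i → lookup v i ≢ + 0

_+ₜ_·_ : {d : ℕ} → Tile d → ℕ → Vec ℤ d → Tile d
p +ₜ k · v = zipWith _+_ p (map (λ x → + k * x) v)

Guards : {d : ℕ} → Polycube d → Tile d → Tile d → Set
Guards {d} P p q =
  q ≡ p ⊎
  Σ (Vec ℤ d) λ v → Σ ℕ λ k →
    IsDirection v × 1 ≤ k × q ≡ p +ₜ k · v ×
    (∀ j → j ≤ k → (p +ₜ j · v) ∈ tiles P)

-- A walk of length at most 2 starting at p consists of at most two
-- axis-parallel unit steps u and w. One step is itself a queen direction.
-- Two steps along different axes sum to a vector in {-1,0,1}^d, so the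
-- queen reaches q in a single move along u + w; two steps along the same
-- axis either cancel (q = p) or agree, and then q = p + 2u with the middle
-- tile p + u of the walk lying in the polycube.
module Submission where

open import Defs
open import Data.Nat using (ℕ; suc; _≤_; z≤n; s≤s)
open import Data.Integer using (ℤ; +_; -[1+_]; _+_; _*_; _-_; ∣_∣)
open import Data.Integer.Properties using (∣i-j∣≡∣j-i∣; i-j≡0⇒i≡j; i≡j⇒i-j≡0; +-identityˡ; +-identityʳ)
open import Data.Integer.Tactic.RingSolver using (solve-∀)
open import Data.Fin using (Fin; _≟_)
open import Data.Vec using (Vec; lookup; zipWith)
open import Data.Vec.Properties using (lookup-zipWith; lookup-map; tabulate∘lookup; tabulate-cong)
open import Data.List.Membership.Propositional using (_∈_)
open import Data.Product using (∃; _,_; proj₂)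
open import Data.Sum using (_⊎_; inj₁; inj₂)
open import Relation.Nullary using (yes; no)
open import Relation.Binary.PropositionalEquality
  using (_≡_; _≢_; _≗_; refl; sym; trans; cong; cong₂; subst; module ≡-Reasoning)

IsSign : ℤ → Set
IsSign z = z ≡ + 1 ⊎ z ≡ -[1+ 0 ]

∣∣≡1⇒sign : ∀ z → ∣ z ∣ ≡ 1 → IsSign z
∣∣≡1⇒sign (+ .1)      refl = inj₁ refl
∣∣≡1⇒sign -[1+ .0 ] refl = inj₂ refl

sign⇒unitEntry : ∀ {z} → IsSign z → IsUnitEntry z
sign⇒unitEntry (inj₁ z≡1)  = inj₂ (inj₂ z≡1)
sign⇒unitEntry (inj₂ z≡-1) = inj₁ z≡-1

sign⇒≢0 : ∀ {z} → IsSign z → z ≢ + 0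
sign⇒≢0 (inj₁ refl) ()
sign⇒≢0 (inj₂ refl) ()

sign-equal-or-opposite : ∀ {x y} → IsSign x → IsSign y → y ≡ x ⊎ x + y ≡ + 0
sign-equal-or-opposite (inj₁ refl) (inj₁ refl) = inj₁ refl
sign-equal-or-opposite (inj₁ refl) (inj₂ refl) = inj₂ refl
sign-equal-or-opposite (inj₂ refl) (inj₁ refl) = inj₂ refl
sign-equal-or-opposite (inj₂ refl) (inj₂ refl) = inj₁ refl

lookup-ext : ∀ {A : Set} {n} {xs ys : Vec A n} → lookup xs ≗ lookup ys → xs ≡ ys
lookup-ext {xs = xs} {ys} eq =
  trans (sym (tabulate∘lookup xs)) (trans (tabulate-cong eq) (tabulate∘lookup ys))

module _ {d : ℕ} where

  _⊖_ : Tile d → Tile d → Vec ℤ d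
  q ⊖ p = zipWith _-_ q p

  lookup-⊖ : ∀ (q p : Tile d) j → lookup (q ⊖ p) j ≡ lookup q j - lookup p j
  lookup-⊖ q p j = lookup-zipWith _-_ j q p

  lookup-+ₜ : ∀ (p : Tile d) k v j → lookup (p +ₜ k · v) j ≡ lookup p j + + k * lookup v j
  lookup-+ₜ p k v j =
    trans (lookup-zipWith _+_ j p _) (cong (λ z → lookup p j + z) (lookup-map j _ v))

  +ₜ-pointwise : ∀ {q} (p : Tile d) k v →
                 (∀ j → lookup q j ≡ lookup p j + + k * lookup v j) → q ≡ p +ₜ k · v
  +ₜ-pointwise p k v eq = lookup-ext λ j → trans (eq j) (sym (lookup-+ₜ p k v j))

  +ₜ-zero : ∀ (p v : Tile d) → p +ₜ 0 · v ≡ p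
  +ₜ-zero p v = sym (+ₜ-pointwise p 0 v λ j → identity (lookup p j) (lookup v j))
    where
    identity : ∀ x y → x ≡ x + + 0 * y
    identity = solve-∀

  +ₜ-⊖ : ∀ (p q : Tile d) → q ≡ p +ₜ 1 · (q ⊖ p)
  +ₜ-⊖ p q = +ₜ-pointwise p 1 (q ⊖ p) λ j →
    trans (identity (lookup q j) (lookup p j))
          (cong (λ z → lookup p j + + 1 * z) (sym (lookup-⊖ q p j)))
    where
    identity : ∀ y x → y ≡ x + + 1 * (y - x)
    identity = solve-∀

  +ₜ-⊖-twice : ∀ (p a q : Tile d) → q ⊖ a ≡ a ⊖ p → q ≡ p +ₜ 2 · (a ⊖ p)
  +ₜ-⊖-twice p a q same = +ₜ-pointwise p 2 (a ⊖ p) λ j → begin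
    lookup q j                                      ≡⟨ identity (lookup q j) (lookup a j) (lookup p j) ⟩
    lookup p j + (lookup a j - lookup p j) + (lookup q j - lookup a j)
      ≡⟨ cong₂ (λ x y → lookup p j + x + y) (sym (lookup-⊖ a p j))
               (trans (sym (lookup-⊖ q a j)) (cong (λ v → lookup v j) same)) ⟩
    lookup p j + lookup (a ⊖ p) j + lookup (a ⊖ p) j ≡⟨ doubling (lookup p j) (lookup (a ⊖ p) j) ⟩
    lookup p j + + 2 * lookup (a ⊖ p) j             ∎
    where
    open ≡-Reasoning
    identity : ∀ z y x → z ≡ x + (y - x) + (z - y)
    identity = solve-∀
    doubling : ∀ x y → x + y + y ≡ x + + 2 * y
    doubling = solve-∀

  ⊖-chain : ∀ (p a q : Tile d) j → lookup (q ⊖ p) j ≡ lookup (a ⊖ p) j + lookup (q ⊖ a) j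
  ⊖-chain p a q j = begin
    lookup (q ⊖ p) j                                      ≡⟨ lookup-⊖ q p j ⟩
    lookup q j - lookup p j                               ≡⟨ identity (lookup q j) (lookup a j) (lookup p j) ⟩
    (lookup a j - lookup p j) + (lookup q j - lookup a j)
      ≡⟨ sym (cong₂ _+_ (lookup-⊖ a p j) (lookup-⊖ q a j)) ⟩
    lookup (a ⊖ p) j + lookup (q ⊖ a) j                   ∎
    where
    open ≡-Reasoning
    identity : ∀ z y x → z - x ≡ (y - x) + (z - y)
    identity = solve-∀

  ⊖≗0⇒≡ : ∀ {p q : Tile d} → (∀ j → lookup (q ⊖ p) j ≡ + 0) → q ≡ p
  ⊖≗0⇒≡ {p} {q} q⊖p≗0 = lookup-ext λ j →
    i-j≡0⇒i≡j (lookup q j) (lookup p j) (trans (sym (lookup-⊖ q p j)) (q⊖p≗0 j))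

  record AxisStep (v : Vec ℤ d) (i : Fin d) : Set where
    constructor axisStep
    field
      on-axis  : IsSign (lookup v i)
      off-axis : ∀ j → j ≢ i → lookup v j ≡ + 0

  adjacent⇒axisStep : ∀ (p q : Tile d) → Adjacent p q → ∃ (AxisStep (q ⊖ p))
  adjacent⇒axisStep p q (i , ∣pᵢ-qᵢ∣≡1 , agree) = i , axisStep
    (∣∣≡1⇒sign _ (trans (cong ∣_∣ (lookup-⊖ q p i))
                        (trans (∣i-j∣≡∣j-i∣ (lookup q i) (lookup p i)) ∣pᵢ-qᵢ∣≡1)))
    (λ j j≢i → trans (lookup-⊖ q p j) (i≡j⇒i-j≡0 (sym (agree j j≢i))))

  axisStep-unitEntry : ∀ {v i} → AxisStep v i → ∀ j → IsUnitEntry (lookup v j)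
  axisStep-unitEntry {i = i} (axisStep sign off) j with j ≟ i
  ... | yes refl = sign⇒unitEntry sign
  ... | no j≢i   = inj₂ (inj₁ (off j j≢i))

  axisStep⇒direction : ∀ {v i} → AxisStep v i → IsDirection v
  axisStep⇒direction {i = i} v-step =
    axisStep-unitEntry v-step , i , sign⇒≢0 (AxisStep.on-axis v-step)

  adjacent⇒direction : ∀ (p q : Tile d) → Adjacent p q → IsDirection (q ⊖ p)
  adjacent⇒direction p q p~q = axisStep⇒direction (proj₂ (adjacent⇒axisStep p q p~q))

  orthogonal-sum-direction : ∀ {u w v : Vec ℤ d} {i i′} →
    AxisStep u i → AxisStep w i′ → i ≢ i′ →
    (∀ j → lookup v j ≡ lookup u j + lookup w j) → IsDirection v
  orthogonal-sum-direction {u} {w} {v} {i} {i′} su sw i≢i′ v≡u+w = entry , i , nonzero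
    where
    v≡u-off-i′ : ∀ j → j ≢ i′ → lookup v j ≡ lookup u j
    v≡u-off-i′ j j≢i′ =
      trans (v≡u+w j)
            (trans (cong (λ z → lookup u j + z) (AxisStep.off-axis sw j j≢i′)) (+-identityʳ _))
    v≡w-off-i : ∀ j → j ≢ i → lookup v j ≡ lookup w j
    v≡w-off-i j j≢i =
      trans (v≡u+w j) (trans (cong (_+ lookup w j) (AxisStep.off-axis su j j≢i)) (+-identityˡ _))
    entry : ∀ j → IsUnitEntry (lookup v j)
    entry j with j ≟ i
    ... | yes refl = subst IsUnitEntry (sym (v≡u-off-i′ j i≢i′)) (axisStep-unitEntry su j)
    ... | no j≢i   = subst IsUnitEntry (sym (v≡w-off-i j j≢i)) (axisStep-unitEntry sw j)
    nonzero : lookup v i ≢ + 0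
    nonzero vᵢ≡0 = sign⇒≢0 (AxisStep.on-axis su) (trans (sym (v≡u-off-i′ i i≢i′)) vᵢ≡0)

  collinear-steps : ∀ {u w : Vec ℤ d} {i} → AxisStep u i → AxisStep w i →
    w ≡ u ⊎ (∀ j → lookup u j + lookup w j ≡ + 0)
  collinear-steps {u} {w} {i} (axisStep uᵢ-sign u-off) (axisStep wᵢ-sign w-off)
    with sign-equal-or-opposite uᵢ-sign wᵢ-sign
  ... | inj₁ wᵢ≡uᵢ   = inj₁ (lookup-ext equal)
    where
    equal : ∀ j → lookup w j ≡ lookup u j
    equal j with j ≟ i
    ... | yes refl = wᵢ≡uᵢ
    ... | no j≢i   = trans (w-off j j≢i) (sym (u-off j j≢i))
  ... | inj₂ uᵢ+wᵢ≡0 = inj₂ cancel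
    where
    cancel : ∀ j → lookup u j + lookup w j ≡ + 0
    cancel j with j ≟ i
    ... | yes refl = uᵢ+wᵢ≡0
    ... | no j≢i   = cong₂ _+_ (u-off j j≢i) (w-off j j≢i)

  guards-by-move : (P : Polycube d) {p q : Tile d} → p ∈ tiles P → q ∈ tiles P →
    IsDirection (q ⊖ p) → Guards P p q
  guards-by-move P {p} {q} p∈P q∈P dir = inj₂ (q ⊖ p , 1 , dir , s≤s z≤n , +ₜ-⊖ p q , on-line)
    where
    on-line : ∀ j → j ≤ 1 → (p +ₜ j · (q ⊖ p)) ∈ tiles P
    on-line 0 z≤n       = subst (_∈ tiles P) (sym (+ₜ-zero p (q ⊖ p))) p∈P
    on-line 1 (s≤s z≤n) = subst (_∈ tiles P) (+ₜ-⊖ p q) q∈P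

  guards-by-double-move : (P : Polycube d) {p a q : Tile d} →
    p ∈ tiles P → a ∈ tiles P → q ∈ tiles P →
    IsDirection (a ⊖ p) → q ⊖ a ≡ a ⊖ p → Guards P p q
  guards-by-double-move P {p} {a} {q} p∈P a∈P q∈P dir same =
    inj₂ (a ⊖ p , 2 , dir , s≤s z≤n , +ₜ-⊖-twice p a q same , on-line)
    where
    on-line : ∀ j → j ≤ 2 → (p +ₜ j · (a ⊖ p)) ∈ tiles P
    on-line 0 z≤n             = subst (_∈ tiles P) (sym (+ₜ-zero p (a ⊖ p))) p∈P
    on-line 1 (s≤s z≤n)       = subst (_∈ tiles P) (+ₜ-⊖ p a) a∈P
    on-line 2 (s≤s (s≤s z≤n)) = subst (_∈ tiles P) (+ₜ-⊖-twice p a q same) q∈P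

  guards-two-steps : (P : Polycube d) {p a q : Tile d} →
    p ∈ tiles P → a ∈ tiles P → q ∈ tiles P → Adjacent p a → Adjacent a q → Guards P p q
  guards-two-steps P {p} {a} {q} p∈P a∈P q∈P p~a a~q
    with adjacent⇒axisStep p a p~a | adjacent⇒axisStep a q a~q
  ... | i , u-step | i′ , w-step with i ≟ i′
  ... | no i≢i′ =
    guards-by-move P p∈P q∈P
      (orthogonal-sum-direction {v = q ⊖ p} u-step w-step i≢i′ (⊖-chain p a q))
  ... | yes refl with collinear-steps u-step w-step
  ...   | inj₁ same   = guards-by-double-move P p∈P a∈P q∈P (axisStep⇒direction u-step) same
  ...   | inj₂ cancel = inj₁ (⊖≗0⇒≡ λ j → trans (⊖-chain p a q j) (cancel j))

lemma5 : (d : ℕ) (P : Polycube d) (p q : Tile d) →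
    p ∈ tiles P → q ∈ tiles P → DistLe P p q 2 → Guards P p q
lemma5 d P p q p∈P q∈P (0 , _ , here _) = inj₁ refl
lemma5 d P p q p∈P q∈P (1 , _ , step _ p~q (here _)) =
  guards-by-move P p∈P q∈P (adjacent⇒direction p q p~q)
lemma5 d P p q p∈P q∈P (2 , _ , step _ p~a (step a∈P a~q (here _))) =
  guards-two-steps P p∈P a∈P q∈P p~a a~q
lemma5 d P p q p∈P q∈P (suc (suc (suc _)) , s≤s (s≤s ()) , _)
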